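{- Let $n$ be a practical number, let $l$ be a positive integer, and let $p$ be a prime with $\gcd(n,p)=1$. Then: (i) If $\sigma(n)$ is even, then $np^l$ is a half-Zumkeller number. (ii) If $\sigma(n)$ is odd, then $np^l$ is a half-Zumkeller number if and only if $p\le\sigma(n)$ and $l$ is odd.
   Context: $\sigma(n)$ denotes the sum of all positive divisors of $n$. A positive integer $n$ is a practical number if every positive integer less than $n$ can be written as a sum of distinct positive divisors of $n$. A positive integer $n$ is a half-Zumkeller number if the set of all positive divisors of $n$ other than $n$ itself can be partitioned into two disjoint parts whose sums are equal. -}

module Defs where

open import Data.Nat using (ℕ; suc; _+_; _<_; _≤_)
open import Data.Nat.Divisibility using (_∣_; _∣?_)
open import Data.List using (List; filter; applyUpTo; _++_)
open import Data.Nat.ListAction using (sum)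
open import Data.List.Relation.Binary.Sublist.Propositional using (_⊆_)
open import Data.List.Relation.Binary.Permutation.Propositional using (_↭_)
open import Data.Product using (Σ; _×_)
open import Relation.Binary.PropositionalEquality using (_≡_)
open import Relation.Nullary using (¬_)

-- Positive divisors of n, in increasing order: those d ∈ {1, …, n} with d ∣ n.
-- (For n = 0 this is the empty list; all uses below assume n ≥ 1.)
divisors : ℕ → List ℕ
divisors n = filter (_∣? n) (applyUpTo suc n)

properDivisors : ℕ → List ℕ
properDivisors n = filter (λ d → ¬? (d ≟ n)) (divisors n)
  where
  open import Data.Nat using (_≟_)
  open import Relation.Nullary.Decidable using (¬?)

σ : ℕ → ℕ
σ n = sum (divisors n)

-- n is practical: n positive and every positive integer m < n is a sum of
-- distinct positive divisors of n (a sub-list of the duplicate-free list of divisors).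
Practical : ℕ → Set
Practical n = 1 ≤ n × (∀ m → 1 ≤ m → m < n → Σ (List ℕ) λ S → S ⊆ divisors n × sum S ≡ m)

-- n is half-Zumkeller: n positive and the proper divisors of n can be split
-- into two disjoint parts A, B (A ++ B is a permutation of the proper divisors)
-- with equal sums.
HalfZumkeller : ℕ → Set
HalfZumkeller n = 1 ≤ n × Σ (List ℕ) λ A → Σ (List ℕ) λ B →
  (A ++ B) ↭ properDivisors n × sum A ≡ sum B

Even : ℕ → Set
Even m = 2 ∣ m

Odd : ℕ → Set
Odd m = ¬ (2 ∣ m)

module Submission where

-- The proper divisors of n·pˡ are arranged in layers (module ProperDivisorsOfProduct):
-- Layers 0 is the list of proper divisors of n and Layers (l+1) = D ++ p·Layers l, where D lists
-- the divisors of n. A list of naturals is complete when every decomposition a + b of its total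
-- is realised by splitting the list into two parts. For a practical n both D and the proper
-- divisors of n are complete, since adding the divisors in increasing order is a sequence of
-- greedy steps (module PracticalNumber). Splittings of sublists add up, and scale with p, so:
--   (i)  if σ(n) is even, halving D in every layer balances the proper divisors of n·pˡ;
--   (ii) if σ(n) = 2S+1 is odd, p = 2q+1 ≤ σ(n) and l is odd, the layers are balanced in pairs
--        using the splittings (S+q+1, r) and (S, S+1) of D, where S = q + r.
-- Conversely, the divisors of n·pˡ prime to p are those of n, and in a balanced splitting their
-- sums in the two parts agree modulo p, which forces p ≤ σ(n); and for even l the layers have odd
-- total, so they cannot be balanced.

open import Defs
open import Data.Empty using (⊥-elim)
open import Data.Product using (Σ; ∃; _×_; _,_; proj₁; proj₂)
open import Data.Sum using (_⊎_; inj₁; inj₂; [_,_])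
open import Function.Base using (_∘_)
open import Function.Bundles using (_⇔_; mk⇔)
open import Relation.Nullary using (¬_; yes; no; contradiction)
open import Relation.Nullary.Decidable using (Dec; ¬?)
open import Relation.Binary.PropositionalEquality
  using (_≡_; refl; sym; trans; cong; cong₂; subst; subst₂; module ≡-Reasoning)

open import Data.Nat
  using (ℕ; zero; suc; _+_; _*_; _^_; _%_; _≤_; _<_; z≤n; s≤s; _≤?_; _≟_;
         NonZero; ≢-nonZero; ≢-nonZero⁻¹; nonTrivial⇒n>1)
open import Data.Nat.Properties
open import Data.Nat.DivMod using ([m+kn]%n≡m%n; m<n⇒m%n≡m)
open import Data.Nat.Divisibility
  using (_∣_; _∣?_; divides; ∣-refl; ∣-trans; _∣0; ∣m+n∣m⇒∣n; ∣m∣n⇒∣m+n; ∣m⇒∣m*n; ∣n⇒∣m*n;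
         ∣1⇒≡1; m∣m*n; *-monoʳ-∣; *-cancelˡ-∣; ∣⇒≤; 0∣⇒≡0)
open import Data.Nat.Coprimality using (Coprime; coprime-divisor; gcd≡1⇒coprime)
open import Data.Nat.GCD using (gcd)
open import Data.Nat.Primality
  using (Prime; euclidsLemma; prime[2]; prime⇒nonZero; prime⇒nonTrivial; prime⇒irreducible)
open import Data.Nat.Tactic.RingSolver using (solve-∀)
open import Data.Nat.ListAction using (sum)
open import Data.Nat.ListAction.Properties using (sum-++; sum-↭)

open import Data.List using (List; []; _∷_; _++_; _∷ʳ_; map; filter; applyUpTo)
open import Data.List.Properties
  using (++-assoc; ++-identityʳ; map-++; applyUpTo-∷ʳ;
         filter-++; filter-accept; filter-reject; filter-all; filter-none)
open import Data.List.Membership.Propositional using (_∈_)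
open import Data.List.Membership.Propositional.Properties
  using (∈-∃++; ∈-filter⁻; ∈-filter⁺; ∈-applyUpTo⁻; ∈-applyUpTo⁺; ∈-++⁻; ∈-++⁺ˡ; ∈-++⁺ʳ; ∈-map⁻; ∈-map⁺)
open import Data.List.Membership.Propositional.Properties.WithK using (unique∧set⇒bag)
open import Data.List.Relation.Unary.Any using (here; there)
import Data.List.Relation.Unary.All as All
open import Data.List.Relation.Unary.AllPairs using ([]; _∷_)
open import Data.List.Relation.Unary.Unique.Propositional using (Unique)
import Data.List.Relation.Unary.Unique.Propositional.Properties as Unique
open import Data.List.Relation.Binary.Sublist.Propositional using (_⊆_)
import Data.List.Relation.Binary.Sublist.Propositional as Sublist
open import Data.List.Relation.Binary.Sublist.Propositional.Properties using (All-resp-⊆; Any-resp-⊆)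
open import Data.List.Relation.Binary.BagAndSetEquality using (∼bag⇒↭)
open import Data.List.Relation.Binary.Permutation.Propositional
  using (_↭_; ↭-refl; ↭-sym; ↭-trans; prep; module PermutationReasoning)
open import Data.List.Relation.Binary.Permutation.Propositional.Properties
  using (++⁺; ++⁺ˡ; shift; shifts; map⁺; filter-↭; ∈-resp-↭; ∷↭∷ʳ)

x+x≡x*2 : ∀ x → x + x ≡ x * 2
x+x≡x*2 x = trans (cong (x +_) (sym (+-identityʳ x))) (*-comm 2 x)

x+1+x≡1+x*2 : ∀ x → x + suc x ≡ suc (x * 2)
x+1+x≡1+x*2 x = trans (+-suc x x) (cong suc (x+x≡x*2 x))

even-or-odd : ∀ m → Even m ⊎ Σ ℕ λ k → m ≡ suc (k * 2)
even-or-odd zero          = inj₁ (divides 0 refl)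
even-or-odd (suc zero)    = inj₂ (0 , refl)
even-or-odd (suc (suc m)) with even-or-odd m
... | inj₁ (divides k refl) = inj₁ (divides (suc k) refl)
... | inj₂ (k , refl)       = inj₂ (suc k , refl)

odd-witness : ∀ {m} → Odd m → Σ ℕ λ k → m ≡ suc (k * 2)
odd-witness {m} m-odd with even-or-odd m
... | inj₁ m-even  = ⊥-elim (m-odd m-even)
... | inj₂ witness = witness

odd+odd : ∀ {a b} → Odd a → Odd b → Even (a + b)
odd+odd a-odd b-odd with odd-witness a-odd | odd-witness b-odd
... | i , refl | j , refl =
  divides (suc (i + j)) (cong suc (trans (+-suc (i * 2) (j * 2)) (cong suc (sym (*-distribʳ-+ 2 i j)))))

odd+even : ∀ {a b} → Odd a → Even b → Odd (a + b)
odd+even {a} {b} a-odd b-even 2∣a+b = a-odd (∣m+n∣m⇒∣n (subst (2 ∣_) (+-comm a b) 2∣a+b) b-even)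

odd*odd : ∀ {a b} → Odd a → Odd b → Odd (a * b)
odd*odd {a} {b} a-odd b-odd 2∣ab = [ a-odd , b-odd ] (euclidsLemma a b prime[2] 2∣ab)

¬even-1 : ¬ Even 1
¬even-1 2∣1 = contradiction (∣1⇒≡1 2∣1) λ ()

prime⇒1<p : ∀ {p} → Prime p → 1 < p
prime⇒1<p {p} p-prime = nonTrivial⇒n>1 p {{prime⇒nonTrivial p-prime}}

sum-map-scale : ∀ k xs → sum (map (k *_) xs) ≡ k * sum xs
sum-map-scale k []       = sym (*-zeroʳ k)
sum-map-scale k (x ∷ xs) = trans (cong (k * x +_) (sum-map-scale k xs)) (sym (*-distribˡ-+ k x (sum xs)))

∈⇒≤sum : ∀ {z} xs → z ∈ xs → z ≤ sum xs
∈⇒≤sum (x ∷ xs) (here refl) = m≤m+n x (sum xs)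
∈⇒≤sum (x ∷ xs) (there z∈xs) = ≤-trans (∈⇒≤sum xs z∈xs) (m≤n+m (sum xs) x)

unique-⊆ : ∀ {xs ys : List ℕ} → xs ⊆ ys → Unique ys → Unique xs
unique-⊆ Sublist.[]               []            = []
unique-⊆ (_ Sublist.∷ʳ xs⊆ys)     (_ ∷ uys)     = unique-⊆ xs⊆ys uys
unique-⊆ (refl Sublist.∷ xs⊆ys)   (y∉ys ∷ uys)  = All-resp-⊆ xs⊆ys y∉ys ∷ unique-⊆ xs⊆ys uys

sum-≤-of-unique-⊆ : ∀ {xs ys : List ℕ} → Unique xs → (∀ {z} → z ∈ xs → z ∈ ys) → sum xs ≤ sum ys
sum-≤-of-unique-⊆ {[]}     _              _     = z≤n
sum-≤-of-unique-⊆ {x ∷ xs} (x∉xs ∷ uxs) xs⊆ys with ∈-∃++ (xs⊆ys (here refl))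
... | B , C , refl = begin
  x + sum xs        ≤⟨ +-monoʳ-≤ x (sum-≤-of-unique-⊆ uxs xs⊆B++C) ⟩
  x + sum (B ++ C)  ≡⟨ sum-↭ (shift x B C) ⟨
  sum (B ++ x ∷ C)  ∎
  where
  open ≤-Reasoning
  xs⊆B++C : ∀ {z} → z ∈ xs → z ∈ B ++ C
  xs⊆B++C z∈xs with ∈-resp-↭ (shift x B C) (xs⊆ys (there z∈xs))
  ... | here z≡x      = ⊥-elim (All.lookup x∉xs z∈xs (sym z≡x))
  ... | there z∈B++C = z∈B++C

unique-↭ : ∀ {xs ys : List ℕ} → Unique xs → Unique ys → (∀ {z} → z ∈ xs ⇔ z ∈ ys) → xs ↭ ys
unique-↭ uxs uys same = ∼bag⇒↭ (unique∧set⇒bag uxs uys same)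

Split : List ℕ → ℕ → ℕ → Set
Split xs a b = Σ (List ℕ) λ A → Σ (List ℕ) λ B → (A ++ B) ↭ xs × sum A ≡ a × sum B ≡ b

Balanced : List ℕ → Set
Balanced xs = Σ ℕ λ h → Split xs h h

split-resp-↭ : ∀ {xs ys a b} → xs ↭ ys → Split xs a b → Split ys a b
split-resp-↭ xs↭ys (A , B , AB↭xs , sA , sB) = A , B , ↭-trans AB↭xs xs↭ys , sA , sB

split-++ : ∀ {xs ys a b c d} → Split xs a b → Split ys c d → Split (xs ++ ys) (a + c) (b + d)
split-++ {xs} {ys} (A , B , AB↭xs , sA , sB) (C , D , CD↭ys , sC , sD) =
  A ++ C , B ++ D , regroup ,
  trans (sum-++ A C) (cong₂ _+_ sA sC) , trans (sum-++ B D) (cong₂ _+_ sB sD)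
  where
  open PermutationReasoning
  regroup : (A ++ C) ++ (B ++ D) ↭ xs ++ ys
  regroup = begin
    (A ++ C) ++ (B ++ D)  ≡⟨ ++-assoc A C (B ++ D) ⟩
    A ++ (C ++ (B ++ D))  ↭⟨ ++⁺ˡ A (shifts C B) ⟩
    A ++ (B ++ (C ++ D))  ≡⟨ ++-assoc A B (C ++ D) ⟨
    (A ++ B) ++ (C ++ D)  ↭⟨ ++⁺ AB↭xs CD↭ys ⟩
    xs ++ ys              ∎

split-scale : ∀ k {xs a b} → Split xs a b → Split (map (k *_) xs) (k * a) (k * b)
split-scale k {xs} (A , B , AB↭xs , sA , sB) =
  map (k *_) A , map (k *_) B ,
  subst (_↭ map (k *_) xs) (map-++ (k *_) A B) (map⁺ (k *_) AB↭xs) ,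
  trans (sum-map-scale k A) (cong (k *_) sA) , trans (sum-map-scale k B) (cong (k *_) sB)

balanced-resp-↭ : ∀ {xs ys} → xs ↭ ys → Balanced xs → Balanced ys
balanced-resp-↭ xs↭ys (h , halves) = h , split-resp-↭ xs↭ys halves

balanced : ∀ {xs a b} → Split xs a b → a ≡ b → Balanced xs
balanced {xs} {a} s a≡b = a , subst (Split xs a) (sym a≡b) s

balanced⇒even : ∀ {A B xs} → A ++ B ↭ xs → sum A ≡ sum B → Even (sum xs)
balanced⇒even {A} {B} {xs} AB↭xs sA≡sB = divides (sum A) (begin
  sum xs          ≡⟨ sum-↭ AB↭xs ⟨
  sum (A ++ B)    ≡⟨ sum-++ A B ⟩
  sum A + sum B   ≡⟨ cong (sum A +_) sA≡sB ⟨
  sum A + sum A   ≡⟨ x+x≡x*2 (sum A) ⟩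
  sum A * 2       ∎)
  where open ≡-Reasoning

Complete : List ℕ → Set
Complete xs = ∀ a b → a + b ≡ sum xs → Split xs a b

complete-[] : Complete []
complete-[] a b a+b≡0 = [] , [] , ↭-refl , sym (m+n≡0⇒m≡0 a a+b≡0) , sym (m+n≡0⇒n≡0 a a+b≡0)

complete-resp-↭ : ∀ {xs ys} → xs ↭ ys → Complete xs → Complete ys
complete-resp-↭ xs↭ys complete a b a+b≡ =
  split-resp-↭ xs↭ys (complete a b (trans a+b≡ (sym (sum-↭ xs↭ys))))

-- The greedy step: a new element not exceeding one more than the current total keeps
-- the list complete (it goes into the second part if it fits there, else into the first).
complete-∷ : ∀ {x xs} → x ≤ suc (sum xs) → Complete xs → Complete (x ∷ xs)
complete-∷ {x} {xs} x≤1+s complete a b a+b≡x+s with x ≤? b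
... | yes x≤b = intoSecond (m≤n⇒∃[o]m+o≡n x≤b)
  where
  intoSecond : ∃ (λ b′ → x + b′ ≡ b) → Split (x ∷ xs) a b
  intoSecond (b′ , refl) with complete a b′ (+-cancelˡ-≡ x _ _ (trans (regroup x a b′) a+b≡x+s))
    where
    regroup : ∀ x a b → x + (a + b) ≡ a + (x + b)
    regroup = solve-∀
  ... | A , B , AB↭xs , sA , sB = A , x ∷ B , ↭-trans (shift x A B) (prep x AB↭xs) , sA , cong (x +_) sB
... | no x≰b = intoFirst (m≤n⇒∃[o]m+o≡n (≤-pred (≤-trans (≰⇒> x≰b) x≤1+s)))
  where
  intoFirst : ∃ (λ a′ → b + a′ ≡ sum xs) → Split (x ∷ xs) a b
  intoFirst (a′ , b+a′≡s) with complete a′ b (trans (+-comm a′ b) b+a′≡s)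
  ... | A , B , AB↭xs , sA , sB = x ∷ A , B , prep x AB↭xs , trans (cong (x +_) sA) x+a′≡a , sB
    where
    x+a′≡a : x + a′ ≡ a
    x+a′≡a = +-cancelʳ-≡ b (x + a′) a (trans (regroup x a′ b) (trans (cong (x +_) b+a′≡s) (sym a+b≡x+s)))
      where
      regroup : ∀ x a b → x + a + b ≡ x + (b + a)
      regroup = solve-∀

complete⇒balanced : ∀ {xs} → Complete xs → Even (sum xs) → Balanced xs
complete⇒balanced complete (divides h sum≡h*2) = h , complete h h (trans (x+x≡x*2 h) (sym sum≡h*2))

pFree : ℕ → List ℕ → List ℕ
pFree p = filter (λ x → ¬? (p ∣? x))

sum-pFree : ∀ p xs → Σ ℕ λ k → sum xs ≡ sum (pFree p xs) + k * p
sum-pFree p []       = 0 , refl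
sum-pFree p (x ∷ xs) with sum-pFree p xs | p ∣? x
... | k , sum≡ | yes (divides q refl) = q + k , trans (cong (q * p +_) sum≡) (regroup p q k (sum (pFree p xs)))
  where
  regroup : ∀ p q k s → q * p + (s + k * p) ≡ s + (q + k) * p
  regroup = solve-∀
... | k , sum≡ | no _                 = k , trans (cong (x +_) sum≡) (sym (+-assoc x _ _))

-- If a list splits into two parts of equal sum, their p-free parts agree modulo p; when the
-- p-free part of the whole list sums to less than p they are equal, so that sum is even.
balanced⇒pFree-even : ∀ p .{{_ : NonZero p}} {A B xs} → A ++ B ↭ xs → sum A ≡ sum B →
                      sum (pFree p xs) < p → Even (sum (pFree p xs))
balanced⇒pFree-even p {A} {B} {xs} AB↭xs sA≡sB small = divides a (begin
  sum (pFree p xs)  ≡⟨ total ⟨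
  a + b             ≡⟨ cong (a +_) a≡b ⟨
  a + a             ≡⟨ x+x≡x*2 a ⟩
  a * 2             ∎)
  where
  open ≡-Reasoning
  a = sum (pFree p A)
  b = sum (pFree p B)
  total : a + b ≡ sum (pFree p xs)
  total = begin
    a + b                           ≡⟨ sum-++ (pFree p A) (pFree p B) ⟨
    sum (pFree p A ++ pFree p B)    ≡⟨ cong sum (filter-++ _ A B) ⟨
    sum (pFree p (A ++ B))          ≡⟨ sum-↭ (filter-↭ _ AB↭xs) ⟩
    sum (pFree p xs)                ∎
  residue : ∀ Y → sum Y % p ≡ sum (pFree p Y) % p
  residue Y with k , sum≡ ← sum-pFree p Y = trans (cong (_% p) sum≡) ([m+kn]%n≡m%n _ k p)
  a≡b : a ≡ b
  a≡b = begin
    a             ≡⟨ m<n⇒m%n≡m (≤-<-trans (subst (a ≤_) total (m≤m+n a b)) small) ⟨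
    a % p         ≡⟨ residue A ⟨
    sum A % p     ≡⟨ cong (_% p) sA≡sB ⟩
    sum B % p     ≡⟨ residue B ⟩
    b % p         ≡⟨ m<n⇒m%n≡m (≤-<-trans (subst (b ≤_) total (m≤n+m b a)) small) ⟩
    b             ∎

divisorsUpTo : ℕ → ℕ → List ℕ
divisorsUpTo M k = filter (_∣? M) (applyUpTo suc k)

∈-divisorsUpTo⁻ : ∀ {M k z} → z ∈ divisorsUpTo M k → 1 ≤ z × z ≤ k × z ∣ M
∈-divisorsUpTo⁻ {M} {k} z∈ with ∈-filter⁻ (_∣? M) {xs = applyUpTo suc k} z∈
... | z∈range , z∣M with ∈-applyUpTo⁻ suc z∈range
... | _ , i<k , refl = s≤s z≤n , i<k , z∣M

∈-divisorsUpTo⁺ : ∀ {M k z} → 1 ≤ z → z ≤ k → z ∣ M → z ∈ divisorsUpTo M k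
∈-divisorsUpTo⁺ {M} (s≤s _) z≤k z∣M = ∈-filter⁺ (_∣? M) (∈-applyUpTo⁺ suc z≤k) z∣M

∈-divisors⁻ : ∀ {M z} → z ∈ divisors M → z ∣ M
∈-divisors⁻ {M} z∈ = proj₂ (proj₂ (∈-divisorsUpTo⁻ {M} {M} z∈))

∈-divisors⁺ : ∀ {M z} .{{_ : NonZero M}} → z ∣ M → z ∈ divisors M
∈-divisors⁺ {M} {zero}  0∣M = contradiction (0∣⇒≡0 0∣M) (≢-nonZero⁻¹ M)
∈-divisors⁺ {M} {suc z} z∣M = ∈-divisorsUpTo⁺ (s≤s z≤n) (∣⇒≤ z∣M) z∣M

unique-divisorsUpTo : ∀ M k → Unique (divisorsUpTo M k)
unique-divisorsUpTo M k =
  Unique.filter⁺ (_∣? M) (Unique.applyUpTo⁺₁ suc k (λ i<j _ → <⇒≢ i<j ∘ suc-injective))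

divisorsUpTo-accept : ∀ {M k} → suc k ∣ M → divisorsUpTo M (suc k) ≡ divisorsUpTo M k ∷ʳ suc k
divisorsUpTo-accept {M} {k} d = begin
  filter (_∣? M) (applyUpTo suc (suc k))              ≡⟨ cong (filter (_∣? M)) (applyUpTo-∷ʳ suc k) ⟨
  filter (_∣? M) (applyUpTo suc k ∷ʳ suc k)           ≡⟨ filter-++ (_∣? M) (applyUpTo suc k) _ ⟩
  divisorsUpTo M k ++ filter (_∣? M) (suc k ∷ [])     ≡⟨ cong (divisorsUpTo M k ++_) (filter-accept (_∣? M) d) ⟩
  divisorsUpTo M k ∷ʳ suc k                           ∎
  where open ≡-Reasoning

divisorsUpTo-reject : ∀ {M k} → ¬ suc k ∣ M → divisorsUpTo M (suc k) ≡ divisorsUpTo M k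
divisorsUpTo-reject {M} {k} ¬d = begin
  filter (_∣? M) (applyUpTo suc (suc k))              ≡⟨ cong (filter (_∣? M)) (applyUpTo-∷ʳ suc k) ⟨
  filter (_∣? M) (applyUpTo suc k ∷ʳ suc k)           ≡⟨ filter-++ (_∣? M) (applyUpTo suc k) _ ⟩
  divisorsUpTo M k ++ filter (_∣? M) (suc k ∷ [])     ≡⟨ cong (divisorsUpTo M k ++_) (filter-reject (_∣? M) ¬d) ⟩
  divisorsUpTo M k ++ []                              ≡⟨ ++-identityʳ _ ⟩
  divisorsUpTo M k                                    ∎
  where open ≡-Reasoning

-- Decides properness of a divisor; this is the filter used in the definition of properDivisors.
isProper? : ∀ M d → Dec (¬ d ≡ M)
isProper? M d = ¬? (d ≟ M)

∈-properDivisors⁻ : ∀ {M z} → z ∈ properDivisors M → z ∣ M × z < M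
∈-properDivisors⁻ {M} z∈ with ∈-filter⁻ (isProper? M) {xs = divisors M} z∈
... | z∈divisors , z≢M with ∈-divisorsUpTo⁻ {M} {M} z∈divisors
... | _ , z≤M , z∣M = z∣M , ≤∧≢⇒< z≤M z≢M

∈-properDivisors⁺ : ∀ {M z} → z ∣ M → z < M → z ∈ properDivisors M
∈-properDivisors⁺ {M@(suc _)} z∣M z<M = ∈-filter⁺ (isProper? M) (∈-divisors⁺ z∣M) (<⇒≢ z<M)

unique-properDivisors : ∀ M → Unique (properDivisors M)
unique-properDivisors M = Unique.filter⁺ (isProper? M) (unique-divisorsUpTo M M)

properDivisors-suc : ∀ k → properDivisors (suc k) ≡ divisorsUpTo (suc k) k
properDivisors-suc k = begin
  filter (isProper? M) (divisors M)                         ≡⟨ cong (filter (isProper? M)) (divisorsUpTo-accept {suc k} {k} ∣-refl) ⟩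
  filter (isProper? M) (divisorsUpTo M k ∷ʳ M)              ≡⟨ filter-++ (isProper? M) (divisorsUpTo M k) _ ⟩
  filter (isProper? M) (divisorsUpTo M k) ++ filter (isProper? M) (M ∷ [])
    ≡⟨ cong₂ _++_ (filter-all (isProper? M) (All.tabulate below-M)) (filter-reject (isProper? M) (λ M≢M → M≢M refl)) ⟩
  divisorsUpTo M k ++ []                                    ≡⟨ ++-identityʳ _ ⟩
  divisorsUpTo M k                                          ∎
  where
  open ≡-Reasoning
  M = suc k
  below-M : ∀ {z} → z ∈ divisorsUpTo M k → ¬ z ≡ M
  below-M z∈ z≡M with ∈-divisorsUpTo⁻ {M} {k} z∈
  ... | _ , z≤k , _ = 1+n≰n (subst (_≤ k) z≡M z≤k)

σ-suc : ∀ k → σ (suc k) ≡ sum (properDivisors (suc k)) + suc k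
σ-suc k = begin
  sum (divisors (suc k))                        ≡⟨ cong sum (divisorsUpTo-accept {suc k} {k} ∣-refl) ⟩
  sum (divisorsUpTo (suc k) k ∷ʳ suc k)         ≡⟨ sum-++ (divisorsUpTo (suc k) k) _ ⟩
  sum (divisorsUpTo (suc k) k) + (suc k + 0)    ≡⟨ cong₂ _+_ (cong sum (properDivisors-suc k)) (sym (+-identityʳ (suc k))) ⟨
  sum (properDivisors (suc k)) + suc k          ∎
  where open ≡-Reasoning

module PracticalNumber {n : ℕ} (practical : Practical n) where

  -- Every m < n is a sum of distinct divisors of n, each at most m, so the divisors
  -- of n up to m sum to at least m.
  divisorsUpTo-sum : ∀ m → m < n → m ≤ sum (divisorsUpTo n m)
  divisorsUpTo-sum zero        _   = z≤n
  divisorsUpTo-sum m@(suc _) m<n with proj₂ practical m (s≤s z≤n) m<n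
  ... | S , S⊆divisors , sumS≡m =
    subst (_≤ sum (divisorsUpTo n m)) sumS≡m
      (sum-≤-of-unique-⊆ (unique-⊆ S⊆divisors (unique-divisorsUpTo n n)) S⊆small)
    where
    S⊆small : ∀ {z} → z ∈ S → z ∈ divisorsUpTo n m
    S⊆small z∈S with ∈-divisorsUpTo⁻ {n} {n} (Any-resp-⊆ S⊆divisors z∈S)
    ... | 1≤z , _ , z∣n = ∈-divisorsUpTo⁺ 1≤z (subst (_ ≤_) sumS≡m (∈⇒≤sum S z∈S)) z∣n

  -- Hence adding the divisors of n in increasing order is a sequence of greedy steps.
  complete-divisorsUpTo : ∀ k → k ≤ n → Complete (divisorsUpTo n k)
  complete-divisorsUpTo zero    _   = complete-[]
  complete-divisorsUpTo (suc k) k<n with suc k ∣? n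
  ... | yes d = subst Complete (sym (divisorsUpTo-accept d))
                  (complete-resp-↭ (∷↭∷ʳ (suc k) _)
                    (complete-∷ (s≤s (divisorsUpTo-sum k k<n)) (complete-divisorsUpTo k (<⇒≤ k<n))))
  ... | no ¬d = subst Complete (sym (divisorsUpTo-reject ¬d)) (complete-divisorsUpTo k (<⇒≤ k<n))

  complete-divisors : Complete (divisors n)
  complete-divisors = complete-divisorsUpTo n ≤-refl

  complete-properDivisors : Complete (properDivisors n)
  complete-properDivisors with proj₁ practical
  ... | s≤s {n = k} _ = subst Complete (sym (properDivisors-suc k)) (complete-divisorsUpTo k (n≤1+n k))

  σ≡properSum+n : σ n ≡ sum (properDivisors n) + n
  σ≡properSum+n with proj₁ practical
  ... | s≤s {n = k} _ = σ-suc k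

  -- A practical number is 1 or even: otherwise 2 < n and the divisors of n up to 2 are just 1.
  one-or-even : n ≡ 1 ⊎ Even n
  one-or-even with 2 ∣? n | n ≟ 1
  ... | yes 2∣n | _     = inj₂ 2∣n
  ... | no _    | yes n≡1 = inj₁ n≡1
  ... | no 2∤n  | no n≢1  = contradiction (divisorsUpTo-sum 2 2<n) (subst (λ S → ¬ 2 ≤ sum S) (sym upTo2) (λ { (s≤s ()) }))
    where
    2<n : 2 < n
    2<n = ≤∧≢⇒< (≤∧≢⇒< (proj₁ practical) (n≢1 ∘ sym)) (λ 2≡n → 2∤n (subst (2 ∣_) 2≡n ∣-refl))
    upTo2 : divisorsUpTo n 2 ≡ 1 ∷ []
    upTo2 = trans (divisorsUpTo-reject 2∤n) (divisorsUpTo-accept (divides n (sym (*-identityʳ n))))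

module ProperDivisorsOfProduct {p : ℕ} (p-prime : Prime p) {n : ℕ} (p∤n : ¬ p ∣ n) where

  instance
    p-nonZero : NonZero p
    p-nonZero = prime⇒nonZero p-prime

    n-nonZero : NonZero n
    n-nonZero = ≢-nonZero (λ n≡0 → p∤n (subst (p ∣_) (sym n≡0) (p ∣0)))

  1<p : 1 < p
  1<p = prime⇒1<p p-prime

  -- The proper divisors of n·pˡ, organised by the power of p they contain:
  -- Layers l = D ∪ pD ∪ … ∪ p^(l-1)D ∪ pˡ·(proper divisors of n), with D the divisors of n.
  Layers : ℕ → List ℕ
  Layers zero    = properDivisors n
  Layers (suc l) = divisors n ++ map (p *_) (Layers l)

  n*p^suc : ∀ l → n * p ^ suc l ≡ p * (n * p ^ l)
  n*p^suc l = trans (sym (*-assoc n p (p ^ l))) (trans (cong (_* p ^ l) (*-comm n p)) (*-assoc p n (p ^ l)))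

  ∣n*p^⇒∣n : ∀ l {z} → ¬ p ∣ z → z ∣ n * p ^ l → z ∣ n
  ∣n*p^⇒∣n zero    _   z∣n*1 = subst (_ ∣_) (*-identityʳ n) z∣n*1
  ∣n*p^⇒∣n (suc l) {z} p∤z z∣N   = ∣n*p^⇒∣n l p∤z (coprime-divisor z⊥p (subst (z ∣_) (n*p^suc l) z∣N))
    where
    z⊥p : Coprime z p
    z⊥p (i∣z , i∣p) with prime⇒irreducible p-prime i∣p
    ... | inj₁ i≡1 = i≡1
    ... | inj₂ refl = contradiction i∣z p∤z

  layers-sound : ∀ l {z} → z ∈ Layers l → z ∣ n * p ^ l × z < n * p ^ l
  layers-sound zero {z} z∈ = subst (λ N → z ∣ N × z < N) (sym (*-identityʳ n)) (∈-properDivisors⁻ z∈)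
  layers-sound (suc l) {z} z∈ with ∈-++⁻ (divisors n) z∈
  ... | inj₁ z∈divisors = ∣m⇒∣m*n (p ^ suc l) z∣n , ≤-<-trans (∣⇒≤ z∣n) (m<m*n n (p ^ suc l) 1<p^suc)
    where
    z∣n = ∈-divisors⁻ z∈divisors
    1<p^suc : 1 < p ^ suc l
    1<p^suc = ^-monoʳ-< p 1<p {0} {suc l} (s≤s z≤n)
  ... | inj₂ z∈p*layer with ∈-map⁻ (p *_) z∈p*layer
  ... | w , w∈ , refl with layers-sound l w∈
  ... | w∣N , w<N = subst (λ N → p * w ∣ N × p * w < N) (sym (n*p^suc l)) (*-monoʳ-∣ p w∣N , *-monoʳ-< p w<N)

  layers-complete : ∀ l {z} → z ∣ n * p ^ l → z < n * p ^ l → z ∈ Layers l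
  layers-complete zero {z} z∣N z<N =
    ∈-properDivisors⁺ (subst (z ∣_) (*-identityʳ n) z∣N) (subst (z <_) (*-identityʳ n) z<N)
  layers-complete (suc l) {z} z∣N z<N with p ∣? z
  ... | no p∤z = ∈-++⁺ˡ (∈-divisors⁺ (∣n*p^⇒∣n (suc l) p∤z z∣N))
  ... | yes (divides w refl) =
    ∈-++⁺ʳ (divisors n) (subst (_∈ map (p *_) (Layers l)) (*-comm p w)
      (∈-map⁺ (p *_) (layers-complete l
        (*-cancelˡ-∣ p (subst₂ _∣_ (*-comm w p) (n*p^suc l) z∣N))
        (*-cancelˡ-< p w (n * p ^ l) (subst₂ _<_ (*-comm w p) (n*p^suc l) z<N)))))

  unique-layers : ∀ l → Unique (Layers l)
  unique-layers zero    = unique-properDivisors n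
  unique-layers (suc l) =
    Unique.++⁺ (unique-divisorsUpTo n n) (Unique.map⁺ (*-cancelˡ-≡ _ _ p) (unique-layers l)) disjoint
    where
    disjoint : ∀ {v} → ¬ (v ∈ divisors n × v ∈ map (p *_) (Layers l))
    disjoint (v∈divisors , v∈p*layer) with ∈-map⁻ (p *_) v∈p*layer
    ... | w , _ , refl = p∤n (∣-trans (m∣m*n w) (∈-divisors⁻ v∈divisors))

  properDivisors↭layers : ∀ l → properDivisors (n * p ^ l) ↭ Layers l
  properDivisors↭layers l = unique-↭ (unique-properDivisors (n * p ^ l)) (unique-layers l)
    (mk⇔ (λ z∈ → let (z∣N , z<N) = ∈-properDivisors⁻ {n * p ^ l} z∈ in layers-complete l z∣N z<N)
         (λ z∈ → let (z∣N , z<N) = layers-sound l z∈ in ∈-properDivisors⁺ z∣N z<N))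

  sum-layers-suc : ∀ l → sum (Layers (suc l)) ≡ σ n + p * sum (Layers l)
  sum-layers-suc l = trans (sum-++ (divisors n) _) (cong (σ n +_) (sum-map-scale p (Layers l)))

  pFree-layers-suc : ∀ l → pFree p (Layers (suc l)) ≡ divisors n
  pFree-layers-suc l = begin
    pFree p (divisors n ++ map (p *_) (Layers l))         ≡⟨ filter-++ _ (divisors n) _ ⟩
    pFree p (divisors n) ++ pFree p (map (p *_) (Layers l)) ≡⟨ cong₂ _++_ (filter-all _ (All.tabulate p∤divisor)) (filter-none _ (All.tabulate p∣multiple)) ⟩
    divisors n ++ []                                    ≡⟨ ++-identityʳ _ ⟩
    divisors n                                          ∎
    where
    open ≡-Reasoning
    p∤divisor : ∀ {z} → z ∈ divisors n → ¬ p ∣ z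
    p∤divisor z∈ p∣z = p∤n (∣-trans p∣z (∈-divisors⁻ z∈))
    p∣multiple : ∀ {z} → z ∈ map (p *_) (Layers l) → ¬ ¬ p ∣ z
    p∣multiple z∈ p∤z with ∈-map⁻ (p *_) z∈
    ... | w , _ , refl = p∤z (m∣m*n w)

halfZumkeller-intro : ∀ {N} → 1 ≤ N → Balanced (properDivisors N) → HalfZumkeller N
halfZumkeller-intro 1≤N (_ , A , B , AB↭ , sA , sB) = 1≤N , A , B , AB↭ , trans sA (sym sB)

module HalfZumkellerCriterion {n p : ℕ} (practical : Practical n) (p-prime : Prime p) (p∤n : ¬ p ∣ n) where

  open PracticalNumber practical
  open ProperDivisorsOfProduct p-prime p∤n

  halfZumkeller-of-layers : ∀ l → Balanced (Layers l) → HalfZumkeller (n * p ^ l)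
  halfZumkeller-of-layers l balanced-layers =
    halfZumkeller-intro (*-mono-≤ (proj₁ practical) (m^n>0 p l))
      (balanced-resp-↭ (↭-sym (properDivisors↭layers l)) balanced-layers)

  -- (i) For even σ(n), n ≠ 1, so n and σ(n) − n are even; halving the divisors of n in every
  -- layer and the proper divisors on top balances all layers at once.
  even-case : Even (σ n) → ∀ l → HalfZumkeller (n * p ^ l)
  even-case σ-even l = halfZumkeller-of-layers l (balanced-layers l)
    where
    n-even : Even n
    n-even with one-or-even
    ... | inj₁ refl   = contradiction σ-even ¬even-1
    ... | inj₂ n-even = n-even
    properSum-even : Even (sum (properDivisors n))
    properSum-even = ∣m+n∣m⇒∣n (subst (2 ∣_) (trans σ≡properSum+n (+-comm _ n)) σ-even) n-even
    balanced-layers : ∀ l → Balanced (Layers l)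
    balanced-layers zero    = complete⇒balanced complete-properDivisors properSum-even
    balanced-layers (suc l) with complete⇒balanced complete-divisors σ-even | balanced-layers l
    ... | s , halves | h , layer-halves = s + p * h , split-++ halves (split-scale p layer-halves)

  -- (ii, ⇒) For odd σ(n) and l ≥ 1, the divisors of n·pˡ prime to p are those of n; if
  -- σ(n) < p, a balanced splitting would halve them, making σ(n) even.
  p≤σ-necessary : Odd (σ n) → ∀ {l} → 1 ≤ l → HalfZumkeller (n * p ^ l) → p ≤ σ n
  p≤σ-necessary σ-odd {suc l} _ (_ , A , B , AB↭ , sA≡sB) with p ≤? σ n
  ... | yes p≤σ = p≤σ
  ... | no  p≰σ = contradiction (subst Even pFree-sum
          (balanced⇒pFree-even p {A} {B} (↭-trans AB↭ (properDivisors↭layers (suc l))) sA≡sB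
            (subst (_< p) (sym pFree-sum) (≰⇒> p≰σ)))) σ-odd
    where
    pFree-sum : sum (pFree p (Layers (suc l))) ≡ σ n
    pFree-sum = cong sum (pFree-layers-suc l)

  -- The remaining statements assume σ(n) odd and p ≤ σ(n); then n ≠ 1, so n is even, p is odd
  -- and σ(n) − n is odd.
  module OddCase (σ-odd : Odd (σ n)) (p≤σ : p ≤ σ n) where

    n-even : Even n
    n-even with one-or-even
    ... | inj₁ refl   = contradiction p≤σ (<⇒≱ 1<p)
    ... | inj₂ n-even = n-even

    p-odd : Odd p
    p-odd 2∣p with prime⇒irreducible p-prime 2∣p
    ... | inj₁ ()
    ... | inj₂ refl = p∤n n-even

    properSum-odd : Odd (sum (properDivisors n))
    properSum-odd properSum-even = σ-odd (subst (2 ∣_) (sym σ≡properSum+n) (∣m∣n⇒∣m+n properSum-even n-even))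

    -- (ii, ⇒) The sum over an even number of layers stays odd, since
    -- sum (Layers (l + 2)) = σ + p·(σ + p·sum (Layers l)); a balanced list has even sum.
    l-odd-necessary : ∀ {l} → HalfZumkeller (n * p ^ l) → Odd l
    l-odd-necessary (_ , A , B , AB↭ , sA≡sB) (divides k refl) =
      odd-layers k (subst Even (sum-↭ (properDivisors↭layers (k * 2))) (balanced⇒even {A} {B} AB↭ sA≡sB))
      where
      odd-layers : ∀ k → Odd (sum (Layers (k * 2)))
      odd-layers zero    = properSum-odd
      odd-layers (suc k) =
        subst Odd (sym (trans (sum-layers-suc (suc (k * 2))) (cong (λ x → σ n + p * x) (sum-layers-suc (k * 2)))))
          (odd+even σ-odd (∣n⇒∣m*n p (odd+odd σ-odd (odd*odd p-odd (odd-layers k)))))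

    -- (ii, ⇐) Write σ(n) = 2S+1, p = 2q+1 and σ(n) − n = 2t+1; as p ≤ σ(n), S = q + r.
    S : ℕ
    S = proj₁ (odd-witness σ-odd)
    σ≡ : σ n ≡ suc (S * 2)
    σ≡ = proj₂ (odd-witness σ-odd)
    q : ℕ
    q = proj₁ (odd-witness p-odd)
    p≡ : p ≡ suc (q * 2)
    p≡ = proj₂ (odd-witness p-odd)
    t : ℕ
    t = proj₁ (odd-witness properSum-odd)
    properSum≡ : sum (properDivisors n) ≡ suc (t * 2)
    properSum≡ = proj₂ (odd-witness properSum-odd)
    q≤S : q ≤ S
    q≤S = *-cancelʳ-≤ q S 2 (≤-pred (subst₂ _≤_ p≡ σ≡ p≤σ))
    r : ℕ
    r = proj₁ (m≤n⇒∃[o]m+o≡n q≤S)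
    q+r≡S : q + r ≡ S
    q+r≡S = proj₂ (m≤n⇒∃[o]m+o≡n q≤S)

    low : Split (divisors n) (S + suc q) r
    low = complete-divisors (S + suc q) r (begin
      S + suc q + r         ≡⟨ +-assoc S (suc q) r ⟩
      S + suc (q + r)       ≡⟨ cong (λ m → S + suc m) q+r≡S ⟩
      S + suc S             ≡⟨ x+1+x≡1+x*2 S ⟩
      suc (S * 2)           ≡⟨ σ≡ ⟨
      σ n                   ∎)
      where open ≡-Reasoning

    high : Split (divisors n) S (suc S)
    high = complete-divisors S (suc S) (trans (x+1+x≡1+x*2 S) (sym σ≡))

    top : Split (properDivisors n) t (suc t)
    top = complete-properDivisors t (suc t) (trans (x+1+x≡1+x*2 t) (sym properSum≡))

    -- The first part of `low` exceeds its second by exactly p, which compensates one extra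
    -- unit in the second part of the layer above.
    shift-by-p : ∀ c → S + suc q + p * c ≡ r + p * suc c
    shift-by-p c = begin
      S + suc q + p * c       ≡⟨ cong (λ m → m + suc q + p * c) q+r≡S ⟨
      q + r + suc q + p * c   ≡⟨ cong (_+ p * c) (regroup q r) ⟩
      r + suc (q * 2) + p * c ≡⟨ cong (λ m → r + m + p * c) p≡ ⟨
      r + p + p * c           ≡⟨ +-assoc r p (p * c) ⟩
      r + (p + p * c)         ≡⟨ cong (r +_) (*-suc p c) ⟨
      r + p * suc c           ∎
      where
      open ≡-Reasoning
      regroup : ∀ q r → q + r + suc q ≡ r + suc (q * 2)
      regroup = solve-∀

    -- Layer pairs (D, p·D) are split by `low` and `high`, the top layer by `top`.
    balanced-odd-layers : ∀ k → Balanced (Layers (suc (k * 2)))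
    balanced-odd-layers zero    = balanced (split-++ low (split-scale p top)) (shift-by-p t)
    balanced-odd-layers (suc k) with balanced-odd-layers k
    ... | h , halves = balanced (split-++ low (split-scale p (split-++ high (split-scale p halves))))
                         (shift-by-p (S + p * h))

    sufficient : ∀ {l} → Odd l → HalfZumkeller (n * p ^ l)
    sufficient l-odd with odd-witness l-odd
    ... | k , refl = halfZumkeller-of-layers (suc (k * 2)) (balanced-odd-layers k)

mainTheorem3 : (n l p : ℕ) → Practical n → 1 ≤ l → Prime p → gcd n p ≡ 1 →
    (Even (σ n) → HalfZumkeller (n * p ^ l)) ×
    (Odd (σ n) → (HalfZumkeller (n * p ^ l) ⇔ (p ≤ σ n × Odd l)))
mainTheorem3 n l p practical 1≤l p-prime gcd≡1 =
  (λ σ-even → even-case σ-even l) ,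
  (λ σ-odd → mk⇔
    (λ hz → let p≤σ = p≤σ-necessary σ-odd 1≤l hz in p≤σ , OddCase.l-odd-necessary σ-odd p≤σ hz)
    (λ (p≤σ , l-odd) → OddCase.sufficient σ-odd p≤σ l-odd))
  where
  p∤n : ¬ p ∣ n
  p∤n p∣n = <⇒≢ (prime⇒1<p p-prime) (sym (gcd≡1⇒coprime gcd≡1 (p∣n , ∣-refl)))
  open HalfZumkellerCriterion practical p-prime p∤n
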